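{- Let $m,n\ge 0$. (a) The maximum size of the edge boundary of a vertex set in $D(m,n)$ is $(2m+n)4^{2m+n}$. (b) A vertex set $M$ of $D(m,n)$ has edge boundary of this maximum size if and only if $M$ is a $2\times$MDS code.
   Context: The Shrikhande graph $\mathrm{Sh}$ is the Cayley graph of $\mathbb{Z}_4^2$ with connecting set $\{(0,1),(1,0),(1,1),(0,3),(3,0),(3,3)\}$. $K=K_4$ is the complete graph on $4$ vertices (Cayley graph of $\mathbb{Z}_2^2$ with connecting set $\{(0,1),(1,0),(1,1)\}$). $D(m,n)=\mathrm{Sh}^m\times K^n$ is the Cartesian product: vertices are tuples $(x_1,\dots,x_m,y_1,\dots,y_n)$, $x_i\in\mathbb{Z}_4^2$, $y_j\in\mathbb{Z}_2^2$, adjacent iff they differ in exactly one coordinate and the differing entries are adjacent in the corresponding factor. The edge boundary of a vertex set $V$ is the set of edges with exactly one endpoint in $V$. A Shrikhande line is the set of $16$ vertices obtained by fixing all coordinates except one $x_i$; a $K$-line is the set of $4$ vertices obtained by fixing all coordinates except one $y_j$. A $2\times$MDS code in $D(m,n)$ is a vertex set $M$ such that the intersection of $M$ with every Shrikhande line consists of $8$ vertices forming (in the copy of $\mathrm{Sh}$ induced by the line) the union of two disjoint independent $4$-sets, and every $K$-line contains exactly $2$ elements of $M$. -}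

module Defs where

open import Data.Bool using (Bool; true; false; _∧_; _∨_; not; if_then_else_)
open import Data.Nat using (ℕ; zero; suc; _+_; _*_; _∸_; _%_)
open import Data.Fin using (Fin; toℕ)
open import Data.Fin.Properties using () renaming (_≟_ to _≟F_)
open import Data.Product using (_×_; _,_; proj₁; proj₂; Σ; ∃)
open import Data.List using (List; []; _∷_; length; filterᵇ; allFin; cartesianProduct; cartesianProductWith; map)
open import Data.Vec using (Vec; []; _∷_; _[_]≔_)
open import Relation.Nullary.Decidable using (⌊_⌋)
open import Relation.Binary.PropositionalEquality using (_≡_)

count : {A : Set} → (A → Bool) → List A → ℕ
count p xs = length (filterᵇ p xs)

eqF : {k : ℕ} → Fin k → Fin k → Bool
eqF a b = ⌊ a ≟F b ⌋

Z4² : Set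
Z4² = Fin 4 × Fin 4

sub4 : Fin 4 → Fin 4 → ℕ
sub4 a b = (toℕ a + 4 ∸ toℕ b) % 4

inS-Sh : ℕ → ℕ → Bool
inS-Sh 0 1 = true
inS-Sh 1 0 = true
inS-Sh 1 1 = true
inS-Sh 0 3 = true
inS-Sh 3 0 = true
inS-Sh 3 3 = true
inS-Sh _ _ = false

ShAdj : Z4² → Z4² → Bool
ShAdj (a , b) (c , d) = inS-Sh (sub4 a c) (sub4 b d)

eqZ4² : Z4² → Z4² → Bool
eqZ4² (a , b) (c , d) = eqF a c ∧ eqF b d

allZ4² : List Z4²
allZ4² = cartesianProduct (allFin 4) (allFin 4)

Z2² : Set
Z2² = Fin 2 × Fin 2

sub2 : Fin 2 → Fin 2 → ℕ
sub2 a b = (toℕ a + 2 ∸ toℕ b) % 2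

inS-K : ℕ → ℕ → Bool
inS-K 0 1 = true
inS-K 1 0 = true
inS-K 1 1 = true
inS-K _ _ = false

KAdj : Z2² → Z2² → Bool
KAdj (a , b) (c , d) = inS-K (sub2 a c) (sub2 b d)

eqZ2² : Z2² → Z2² → Bool
eqZ2² (a , b) (c , d) = eqF a c ∧ eqF b d

allZ2² : List Z2²
allZ2² = cartesianProduct (allFin 2) (allFin 2)

eqVec : {A : Set} → (A → A → Bool) → {k : ℕ} → Vec A k → Vec A k → Bool
eqVec eq [] [] = true
eqVec eq (x ∷ xs) (y ∷ ys) = eq x y ∧ eqVec eq xs ys

adjVec : {A : Set} → (A → A → Bool) → (A → A → Bool) →
         {k : ℕ} → Vec A k → Vec A k → Bool
adjVec eq adj [] [] = false
adjVec eq adj (x ∷ xs) (y ∷ ys) =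
  (adj x y ∧ eqVec eq xs ys) ∨ (eq x y ∧ adjVec eq adj xs ys)

allVec : {A : Set} → List A → (k : ℕ) → List (Vec A k)
allVec xs zero = [] ∷ []
allVec xs (suc k) = cartesianProductWith _∷_ xs (allVec xs k)

-- The graph D(m,n) = Sh^m × K^n

Vertex : ℕ → ℕ → Set
Vertex m n = Vec Z4² m × Vec Z2² n

eqVertex : {m n : ℕ} → Vertex m n → Vertex m n → Bool
eqVertex (x , y) (x' , y') = eqVec eqZ4² x x' ∧ eqVec eqZ2² y y'

DAdj : {m n : ℕ} → Vertex m n → Vertex m n → Bool
DAdj (x , y) (x' , y') =
  (adjVec eqZ4² ShAdj x x' ∧ eqVec eqZ2² y y') ∨
  (eqVec eqZ4² x x' ∧ adjVec eqZ2² KAdj y y')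

allVertices : (m n : ℕ) → List (Vertex m n)
allVertices m n = cartesianProduct (allVec allZ4² m) (allVec allZ2² n)

VertexSet : ℕ → ℕ → Set
VertexSet m n = Vertex m n → Bool

-- Size of the edge boundary of M: the number of edges {u,v} with exactly
-- one endpoint in M; each such edge is counted once as the ordered pair
-- (u,v) with u ∈ M and v ∉ M.
edgeBoundary : {m n : ℕ} → VertexSet m n → ℕ
edgeBoundary {m} {n} M =
  count (λ p → M (proj₁ p) ∧ not (M (proj₂ p)) ∧ DAdj (proj₁ p) (proj₂ p))
        (cartesianProduct (allVertices m n) (allVertices m n))

IndependentSh : (Z4² → Bool) → Set
IndependentSh A = (z w : Z4²) → A z ≡ true → A w ≡ true → ShAdj z w ≡ false

UnionOfTwoIndependent4Sets : (Z4² → Bool) → Set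
UnionOfTwoIndependent4Sets S =
  count S allZ4² ≡ 8 ×
  Σ (Z4² → Bool) λ A → Σ (Z4² → Bool) λ B →
    count A allZ4² ≡ 4 × count B allZ4² ≡ 4 ×
    IndependentSh A × IndependentSh B ×
    ((z : Z4²) → (A z ∧ B z) ≡ false) ×
    ((z : Z4²) → S z ≡ (A z ∨ B z))

shLineTrace : {m n : ℕ} → VertexSet m n → Vertex m n → Fin m → (Z4² → Bool)
shLineTrace M (x , y) i z = M ((x [ i ]≔ z) , y)

kLineTrace : {m n : ℕ} → VertexSet m n → Vertex m n → Fin n → (Z2² → Bool)
kLineTrace M (x , y) j z = M (x , (y [ j ]≔ z))

Is2xMDS : {m n : ℕ} → VertexSet m n → Set
Is2xMDS {m} {n} M =
  ((v : Vertex m n) (i : Fin m) → UnionOfTwoIndependent4Sets (shLineTrace M v i)) ×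
  ((v : Vertex m n) (j : Fin n) → count (kLineTrace M v j) allZ2² ≡ 2)

-- Sh and K4 obey boundary laws: for N ⊆ V, ∂N + defect N = c·|V|.  For Sh, c = 2 and the
-- defect counts monochromatic triangles: each edge lies in exactly two of the 32 triangles,
-- and a triangle that is not monochromatic has exactly two cut edges.  For K4, c = 1 and the
-- defect is (|N| - 2)².  The boundary of a set in a Cartesian product is the sum of the
-- boundaries of its rows and columns, so D(m,n) = Sh^m □ K^n obeys the law with c = 2m + n
-- and the sum of the defects of all lines as defect.  Hence ∂M ≤ (2m + n)·4^(2m+n), with
-- equality iff every K-line meets M in two vertices and every Shrikhande line in a set without
-- monochromatic triangles; an exhaustive search identifies the latter sets with the unions of
-- two disjoint independent 4-sets.  A parity code attains the bound.

module Submission where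

open import Defs
open import Data.Bool using (Bool; true; false; _∧_; _∨_; not; if_then_else_; _xor_; T)
open import Data.Bool.ListAction using (all; any)
open import Data.Bool.Properties using (T-∧; T-∨; T-≡; T?; ∧-zeroʳ; xor-assoc; xor-comm) renaming (_≟_ to _≟ᵇ_)
open import Data.Empty using (⊥; ⊥-elim)
open import Data.Fin using (Fin; zero; suc; #_)
open import Data.Fin.Properties using () renaming (_≟_ to _≟F_)
open import Data.List using (List; []; _∷_; _++_; map; length; filterᵇ; concatMap; cartesianProductWith; cartesianProduct; allFin)
open import Data.List.Properties using (length-++; length-map; map-tabulate)
open import Data.List.Membership.Propositional using (_∈_; find)
open import Data.List.Membership.Propositional.Properties using (∈-cartesianProductWith⁺; ∈-cartesianProduct⁺; ∈-allFin; ∈-filter⁺; ∈-filter⁻)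
open import Data.List.Relation.Unary.All as All using ()
open import Data.List.Relation.Unary.All.Properties using (all⁺; all⁻)
open import Data.List.Relation.Unary.Any using (here; there)
open import Data.List.Relation.Unary.Any.Properties using (any⁻)
open import Data.Maybe using (Maybe; just; nothing; fromMaybe; maybe′)
import Data.Maybe as Maybe
open import Data.Maybe.Properties using (just-injective)
open import Data.Nat using (ℕ; zero; suc; _+_; _*_; _^_; _≤_; _≡ᵇ_; ∣_-_∣)
open import Data.Nat.Properties
open import Algebra.Properties.CommutativeSemigroup +-commutativeSemigroup using () renaming (interchange to +-interchange)
open import Data.Nat.Solver using (module +-*-Solver)
open import Data.Product using (_×_; _,_; proj₁; proj₂; Σ; ∃-syntax; uncurry)
open import Data.Sum using (inj₁; inj₂)
open import Data.Vec using (Vec; []; _∷_; _[_]≔_)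
open import Function.Base using (_∘_)
open import Function.Bundles using (_⇔_; mk⇔; Equivalence)
open import Function.Properties.Equivalence using () renaming (trans to ⇔-trans)
open import Relation.Nullary using (yes; no; does; contradiction)
open import Relation.Nullary.Decidable using (toWitness; fromWitness)
open import Relation.Binary.PropositionalEquality using (_≡_; refl; sym; trans; cong; cong₂; subst; subst₂; _≗_; module ≡-Reasoning)

open +-*-Solver using (solve; _:+_; _:*_; _:=_)

private
  variable
    A B C X : Set

T-not⇒¬T : ∀ {b} → T (not b) → T b → ⊥
T-not⇒¬T {true} ()
T-not⇒¬T {false} _ ()

∧⁻ : ∀ a b → a ∧ b ≡ true → a ≡ true × b ≡ true
∧⁻ true b eq = refl , eq

⇒ᵇ-elim : ∀ a b → not a ∨ b ≡ true → a ≡ true → b ≡ true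
⇒ᵇ-elim true b eq refl = eq

≟ᵇ-sound : ∀ {a b} → does (a ≟ᵇ b) ≡ true → a ≡ b
≟ᵇ-sound {true} {true} _ = refl
≟ᵇ-sound {false} {false} _ = refl

xor-swap : ∀ a b c → a xor (b xor c) ≡ b xor (a xor c)
xor-swap a b c = trans (sym (xor-assoc a b c)) (trans (cong (_xor c) (xor-comm a b)) (xor-assoc b a c))

+≡⇒[≡⇔≡0] : ∀ {a b c} → a + b ≡ c → (a ≡ c ⇔ b ≡ 0)
+≡⇒[≡⇔≡0] {a} {b} a+b≡c = mk⇔
  (λ a≡c → +-cancelˡ-≡ a b 0 (trans a+b≡c (trans (sym a≡c) (sym (+-identityʳ a)))))
  (λ b≡0 → trans (sym (+-identityʳ a)) (trans (cong (a +_) (sym b≡0)) a+b≡c))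

⟦_⟧ : Bool → ℕ
⟦ true ⟧ = 1
⟦ false ⟧ = 0

∑ : List A → (A → ℕ) → ℕ
∑ [] f = 0
∑ (x ∷ xs) f = f x + ∑ xs f

syntax ∑ xs (λ x → e) = ∑[ x ∈ xs ] e

∑-cong : ∀ (xs : List A) {f g : A → ℕ} → (∀ x → f x ≡ g x) → ∑ xs f ≡ ∑ xs g
∑-cong [] f≗g = refl
∑-cong (x ∷ xs) f≗g = cong₂ _+_ (f≗g x) (∑-cong xs f≗g)

∑-zero : ∀ (xs : List A) → ∑[ x ∈ xs ] 0 ≡ 0
∑-zero [] = refl
∑-zero (x ∷ xs) = ∑-zero xs

∑-const : ∀ (xs : List A) k → ∑[ x ∈ xs ] k ≡ length xs * k
∑-const [] k = refl
∑-const (x ∷ xs) k = cong (k +_) (∑-const xs k)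

∑-+ : ∀ (xs : List A) (f g : A → ℕ) → ∑[ x ∈ xs ] (f x + g x) ≡ ∑ xs f + ∑ xs g
∑-+ [] f g = refl
∑-+ (x ∷ xs) f g = trans (cong (f x + g x +_) (∑-+ xs f g)) (+-interchange (f x) (g x) _ _ )

∑-*ˡ : ∀ (xs : List A) k (f : A → ℕ) → ∑[ x ∈ xs ] (k * f x) ≡ k * ∑ xs f
∑-*ˡ [] k f = sym (*-zeroʳ k)
∑-*ˡ (x ∷ xs) k f = trans (cong (k * f x +_) (∑-*ˡ xs k f)) (sym (*-distribˡ-+ k (f x) (∑ xs f)))

∑-++ : ∀ (xs ys : List A) (f : A → ℕ) → ∑ (xs ++ ys) f ≡ ∑ xs f + ∑ ys f
∑-++ [] ys f = refl
∑-++ (x ∷ xs) ys f = trans (cong (f x +_) (∑-++ xs ys f)) (sym (+-assoc (f x) _ _))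

∑-map : ∀ (h : A → B) (xs : List A) (f : B → ℕ) → ∑ (map h xs) f ≡ ∑[ x ∈ xs ] f (h x)
∑-map h [] f = refl
∑-map h (x ∷ xs) f = cong (f (h x) +_) (∑-map h xs f)

∑-concatMap : ∀ (h : A → List B) (xs : List A) (f : B → ℕ) →
  ∑ (concatMap h xs) f ≡ ∑[ x ∈ xs ] ∑ (h x) f
∑-concatMap h [] f = refl
∑-concatMap h (x ∷ xs) f = trans (∑-++ (h x) _ f) (cong (∑ (h x) f +_) (∑-concatMap h xs f))

∑-cartesianProductWith : ∀ (h : A → B → C) (xs : List A) (ys : List B) (f : C → ℕ) →
  ∑ (cartesianProductWith h xs ys) f ≡ ∑[ x ∈ xs ] ∑[ y ∈ ys ] f (h x y)
∑-cartesianProductWith h [] ys f = refl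
∑-cartesianProductWith h (x ∷ xs) ys f =
  trans (∑-++ (map (h x) ys) _ f) (cong₂ _+_ (∑-map (h x) ys f) (∑-cartesianProductWith h xs ys f))

∑-comm : ∀ (xs : List A) (ys : List B) (f : A → B → ℕ) →
  ∑[ x ∈ xs ] ∑[ y ∈ ys ] f x y ≡ ∑[ y ∈ ys ] ∑[ x ∈ xs ] f x y
∑-comm [] ys f = sym (∑-zero ys)
∑-comm (x ∷ xs) ys f =
  trans (cong (∑ ys (f x) +_) (∑-comm xs ys f)) (sym (∑-+ ys (f x) (λ y → ∑[ x′ ∈ xs ] f x′ y)))

∑-filterᵇ : ∀ (p : A → Bool) (xs : List A) (f : A → ℕ) →
  ∑[ x ∈ xs ] (if p x then f x else 0) ≡ ∑ (filterᵇ p xs) f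
∑-filterᵇ p [] f = refl
∑-filterᵇ p (x ∷ xs) f with p x
... | true = cong (f x +_) (∑-filterᵇ p xs f)
... | false = ∑-filterᵇ p xs f

∑≡0⇒ : ∀ (xs : List A) (f : A → ℕ) → ∑ xs f ≡ 0 → ∀ {x} → x ∈ xs → f x ≡ 0
∑≡0⇒ (y ∷ xs) f ∑≡0 (here refl) = m+n≡0⇒m≡0 (f y) ∑≡0
∑≡0⇒ (y ∷ xs) f ∑≡0 (there x∈xs) = ∑≡0⇒ xs f (m+n≡0⇒n≡0 (f y) ∑≡0) x∈xs

∑≡0⇐ : ∀ (xs : List A) (f : A → ℕ) → (∀ x → f x ≡ 0) → ∑ xs f ≡ 0
∑≡0⇐ xs f f≗0 = trans (∑-cong xs f≗0) (∑-zero xs)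

count≡∑ : ∀ (p : A → Bool) (xs : List A) → count p xs ≡ ∑[ x ∈ xs ] ⟦ p x ⟧
count≡∑ p [] = refl
count≡∑ p (x ∷ xs) with p x
... | true = cong suc (count≡∑ p xs)
... | false = count≡∑ p xs

count-cong : ∀ {p q : A → Bool} (xs : List A) → (∀ x → p x ≡ q x) → count p xs ≡ count q xs
count-cong {p = p} {q} xs p≗q =
  trans (count≡∑ p xs) (trans (∑-cong xs (λ x → cong ⟦_⟧ (p≗q x))) (sym (count≡∑ q xs)))

length-cartesianProductWith : ∀ (h : A → B → C) (xs : List A) (ys : List B) →
  length (cartesianProductWith h xs ys) ≡ length xs * length ys
length-cartesianProductWith h [] ys = refl
length-cartesianProductWith h (x ∷ xs) ys = trans (length-++ (map (h x) ys))
  (cong₂ _+_ (length-map (h x) ys) (length-cartesianProductWith h xs ys))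

∑⟦⟧≡0⇔ : ∀ (p : A → Bool) (xs : List A) → ∑[ x ∈ xs ] ⟦ p x ⟧ ≡ 0 ⇔ all (λ x → not (p x)) xs ≡ true
∑⟦⟧≡0⇔ p [] = mk⇔ (λ _ → refl) (λ _ → refl)
∑⟦⟧≡0⇔ p (x ∷ xs) with p x
... | true = mk⇔ (λ ()) (λ ())
... | false = ∑⟦⟧≡0⇔ p xs

all-∈ : ∀ (p : A → Bool) {xs} → all p xs ≡ true → ∀ {x} → x ∈ xs → p x ≡ true
all-∈ p {xs} eq x∈xs = Equivalence.to T-≡ (All.lookup (all⁺ p xs (Equivalence.from T-≡ eq)) x∈xs)

any-∈ : ∀ (p : A → Bool) xs → any p xs ≡ true → ∃[ x ] (x ∈ xs × p x ≡ true)
any-∈ p xs eq = let x , x∈xs , px = find (any⁻ p xs (Equivalence.from T-≡ eq)) in x , x∈xs , Equivalence.to T-≡ px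

all-intro : ∀ (p : A → Bool) xs → (∀ x → p x ≡ true) → all p xs ≡ true
all-intro p [] h = refl
all-intro p (x ∷ xs) h = cong₂ _∧_ (h x) (all-intro p xs h)

-- Graphs with a boundary law; Cartesian products and powers

cut : {V : Set} → (V → Bool) → V → V → ℕ
cut N u v = ⟦ N u ∧ not (N v) ⟧

boundary : {V : Set} → List V → (V → V → Bool) → (V → Bool) → ℕ
boundary vs adj N = ∑[ u ∈ vs ] ∑[ v ∈ vs ] (if adj u v then cut N u v else 0)

boundary-cong : {V : Set} (vs : List V) (adj : V → V → Bool) {N N′ : V → Bool} →
  (∀ v → N v ≡ N′ v) → boundary vs adj N ≡ boundary vs adj N′
boundary-cong vs adj N≗N′ = ∑-cong vs λ u → ∑-cong vs λ v →
  cong (λ c → if adj u v then c else 0) (cong₂ (λ a b → ⟦ a ∧ not b ⟧) (N≗N′ u) (N≗N′ v))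

Kronecker : (A → A → Bool) → List A → Set
Kronecker eqᵇ xs = ∀ x (g : _ → ℕ) → ∑[ y ∈ xs ] (if eqᵇ x y then g y else 0) ≡ g x

eqF-suc : ∀ {k} (i j : Fin k) → eqF (suc i) (suc j) ≡ eqF i j
eqF-suc i j with i ≟F j
... | yes _ = refl
... | no _ = refl

allFin-suc : ∀ k → allFin (suc k) ≡ zero ∷ map suc (allFin k)
allFin-suc k = cong (zero ∷_) (sym (map-tabulate (λ j → j) suc))

Kronecker-allFin : ∀ k → Kronecker (eqF {k}) (allFin k)
Kronecker-allFin (suc k) i g =
  trans (cong (λ js → ∑[ j ∈ js ] (if eqF i j then g j else 0)) (allFin-suc k)) (split i)
  where
  open ≡-Reasoning
  split : ∀ i → ∑[ j ∈ zero ∷ map suc (allFin k) ] (if eqF i j then g j else 0) ≡ g i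
  split zero = begin
      g zero + ∑[ j ∈ map suc (allFin k) ] (if eqF zero j then g j else 0)
    ≡⟨ cong (g zero +_) (trans (∑-map suc (allFin k) _) (∑-zero (allFin k))) ⟩
      g zero + 0
    ≡⟨ +-identityʳ (g zero) ⟩
      g zero
    ∎
  split (suc i) = begin
      ∑[ j ∈ map suc (allFin k) ] (if eqF (suc i) j then g j else 0)
    ≡⟨ ∑-map suc (allFin k) _ ⟩
      ∑[ j ∈ allFin k ] (if eqF (suc i) (suc j) then g (suc j) else 0)
    ≡⟨ ∑-cong (allFin k) (λ j → cong (λ b → if b then g (suc j) else 0) (eqF-suc i j)) ⟩
      ∑[ j ∈ allFin k ] (if eqF i j then g (suc j) else 0)
    ≡⟨ Kronecker-allFin k i (λ j → g (suc j)) ⟩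
      g (suc i)
    ∎

if-∧ : ∀ (a b : Bool) (n : ℕ) → (if a ∧ b then n else 0) ≡ (if a then (if b then n else 0) else 0)
if-∧ true b n = refl
if-∧ false b n = refl

Kronecker-cartesianProductWith : ∀ {eqA : A → A → Bool} {eqB : B → B → Bool} {eqC : C → C → Bool}
  (h : A → B → C) {xs ys} → (∀ x y x′ y′ → eqC (h x y) (h x′ y′) ≡ eqA x x′ ∧ eqB y y′) →
  Kronecker eqA xs → Kronecker eqB ys →
  ∀ x y (g : C → ℕ) → ∑[ w ∈ cartesianProductWith h xs ys ] (if eqC (h x y) w then g w else 0) ≡ g (h x y)
Kronecker-cartesianProductWith {eqA = eqA} {eqB} {eqC} h {xs} {ys} eqC-h δA δB x y g = begin
    ∑[ w ∈ cartesianProductWith h xs ys ] (if eqC (h x y) w then g w else 0)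
  ≡⟨ ∑-cartesianProductWith h xs ys _ ⟩
    ∑[ x′ ∈ xs ] ∑[ y′ ∈ ys ] (if eqC (h x y) (h x′ y′) then g (h x′ y′) else 0)
  ≡⟨ ∑-cong xs (λ x′ → ∑-cong ys λ y′ →
       trans (cong (λ b → if b then _ else 0) (eqC-h x y x′ y′)) (if-∧ (eqA x x′) (eqB y y′) _)) ⟩
    ∑[ x′ ∈ xs ] ∑[ y′ ∈ ys ] (if eqA x x′ then (if eqB y y′ then g (h x′ y′) else 0) else 0)
  ≡⟨ ∑-cong xs (λ x′ → if-∑ (eqA x x′) ys) ⟩
    ∑[ x′ ∈ xs ] (if eqA x x′ then ∑[ y′ ∈ ys ] (if eqB y y′ then g (h x′ y′) else 0) else 0)
  ≡⟨ δA x _ ⟩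
    ∑[ y′ ∈ ys ] (if eqB y y′ then g (h x y′) else 0)
  ≡⟨ δB y _ ⟩
    g (h x y)
  ∎
  where
  open ≡-Reasoning
  if-∑ : ∀ b (zs : List B) {F : B → ℕ} → ∑[ z ∈ zs ] (if b then F z else 0) ≡ (if b then ∑ zs F else 0)
  if-∑ true zs = refl
  if-∑ false zs = ∑-zero zs

record FiniteGraph : Set₁ where
  field
    V : Set
    vertices : List V
    ∈-vertices : ∀ v → v ∈ vertices
    eqᵇ : V → V → Bool
    eqᵇ-sound : ∀ u v → T (eqᵇ u v) → u ≡ v
    eqᵇ-Kronecker : Kronecker eqᵇ vertices
    adj : V → V → Bool
    adj-irrefl : ∀ v → adj v v ≡ false

  ∂ : (V → Bool) → ℕ
  ∂ = boundary vertices adj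

record MaxBoundary (G : FiniteGraph) : Set where
  open FiniteGraph G
  field
    ratio : ℕ
    defect : (V → Bool) → ℕ
    ∂+defect : ∀ N → ∂ N + defect N ≡ ratio * length vertices

open FiniteGraph
open MaxBoundary

-- The hypothesis holds for product adjacency because adjacency is irreflexive.
if-product-adjacency : ∀ a e e′ b (n : ℕ) → (T e′ → a ≡ false) →
  (if (a ∧ e) ∨ (e′ ∧ b) then n else 0) ≡
  (if e then (if a then n else 0) else 0) + (if e′ then (if b then n else 0) else 0)
if-product-adjacency false true true true n _ = refl
if-product-adjacency false true true false n _ = refl
if-product-adjacency false true false b n _ = refl
if-product-adjacency false false true true n _ = refl
if-product-adjacency false false true false n _ = refl
if-product-adjacency false false false b n _ = refl
if-product-adjacency true e true b n a≡false with () ← a≡false _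
if-product-adjacency true true false b n _ = sym (+-identityʳ n)
if-product-adjacency true false false b n _ = refl

module CartesianProduct (G H : FiniteGraph) {C : Set} (_⊗_ : V G → V H → C) (adj⊗ : C → C → Bool)
  (adj⊗-def : ∀ x y x′ y′ → adj⊗ (x ⊗ y) (x′ ⊗ y′) ≡ (adj G x x′ ∧ eqᵇ H y y′) ∨ (eqᵇ G x x′ ∧ adj H y y′))
  where

  vertices⊗ : List C
  vertices⊗ = cartesianProductWith _⊗_ (vertices G) (vertices H)

  row : (C → Bool) → V H → V G → Bool
  row N y x = N (x ⊗ y)

  column : (C → Bool) → V G → V H → Bool
  column N x y = N (x ⊗ y)

  neighbourhood-split : ∀ N x y →
    ∑[ w ∈ vertices⊗ ] (if adj⊗ (x ⊗ y) w then cut N (x ⊗ y) w else 0) ≡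
    ∑[ x′ ∈ vertices G ] (if adj G x x′ then cut N (x ⊗ y) (x′ ⊗ y) else 0) +
    ∑[ y′ ∈ vertices H ] (if adj H y y′ then cut N (x ⊗ y) (x ⊗ y′) else 0)
  neighbourhood-split N x y = begin
      ∑[ w ∈ vertices⊗ ] (if adj⊗ (x ⊗ y) w then cut N (x ⊗ y) w else 0)
    ≡⟨ ∑-cartesianProductWith _⊗_ (vertices G) (vertices H) _ ⟩
      ∑[ x′ ∈ vertices G ] ∑[ y′ ∈ vertices H ] (if adj⊗ (x ⊗ y) (x′ ⊗ y′) then cut N (x ⊗ y) (x′ ⊗ y′) else 0)
    ≡⟨ ∑-cong (vertices G) (λ x′ → ∑-cong (vertices H) λ y′ → split x′ y′) ⟩
      ∑[ x′ ∈ vertices G ] ∑[ y′ ∈ vertices H ] (inRow x′ y′ + inColumn x′ y′)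
    ≡⟨ ∑-cong (vertices G) (λ x′ → ∑-+ (vertices H) (inRow x′) (inColumn x′)) ⟩
      ∑[ x′ ∈ vertices G ] (∑ (vertices H) (inRow x′) + ∑ (vertices H) (inColumn x′))
    ≡⟨ ∑-+ (vertices G) _ _ ⟩
      ∑[ x′ ∈ vertices G ] ∑ (vertices H) (inRow x′) + ∑[ x′ ∈ vertices G ] ∑ (vertices H) (inColumn x′)
    ≡⟨ cong₂ _+_ (∑-cong (vertices G) (λ x′ → eqᵇ-Kronecker H y _))
                 (trans (∑-comm (vertices G) (vertices H) inColumn)
                        (∑-cong (vertices H) (λ y′ → eqᵇ-Kronecker G x _))) ⟩
      ∑[ x′ ∈ vertices G ] (if adj G x x′ then cut N (x ⊗ y) (x′ ⊗ y) else 0) +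
      ∑[ y′ ∈ vertices H ] (if adj H y y′ then cut N (x ⊗ y) (x ⊗ y′) else 0)
    ∎
    where
    open ≡-Reasoning
    inRow inColumn : V G → V H → ℕ
    inRow x′ y′ = if eqᵇ H y y′ then (if adj G x x′ then cut N (x ⊗ y) (x′ ⊗ y′) else 0) else 0
    inColumn x′ y′ = if eqᵇ G x x′ then (if adj H y y′ then cut N (x ⊗ y) (x′ ⊗ y′) else 0) else 0
    split : ∀ x′ y′ → (if adj⊗ (x ⊗ y) (x′ ⊗ y′) then cut N (x ⊗ y) (x′ ⊗ y′) else 0) ≡ inRow x′ y′ + inColumn x′ y′
    split x′ y′ = trans (cong (λ b → if b then cut N (x ⊗ y) (x′ ⊗ y′) else 0) (adj⊗-def x y x′ y′))
      (if-product-adjacency (adj G x x′) (eqᵇ H y y′) (eqᵇ G x x′) (adj H y y′) _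
        (λ x≡x′ → subst (λ x″ → adj G x x″ ≡ false) (eqᵇ-sound G x x′ x≡x′) (adj-irrefl G x)))

  ∂⊗ : ∀ N → boundary vertices⊗ adj⊗ N ≡ ∑[ y ∈ vertices H ] ∂ G (row N y) + ∑[ x ∈ vertices G ] ∂ H (column N x)
  ∂⊗ N = begin
      boundary vertices⊗ adj⊗ N
    ≡⟨ ∑-cartesianProductWith _⊗_ (vertices G) (vertices H) _ ⟩
      ∑[ x ∈ vertices G ] ∑[ y ∈ vertices H ] ∑[ w ∈ vertices⊗ ] (if adj⊗ (x ⊗ y) w then cut N (x ⊗ y) w else 0)
    ≡⟨ ∑-cong (vertices G) (λ x → ∑-cong (vertices H) λ y → neighbourhood-split N x y) ⟩
      ∑[ x ∈ vertices G ] ∑[ y ∈ vertices H ] (inRow x y + inColumn x y)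
    ≡⟨ trans (∑-cong (vertices G) (λ x → ∑-+ (vertices H) (inRow x) (inColumn x))) (∑-+ (vertices G) _ _) ⟩
      ∑[ x ∈ vertices G ] ∑ (vertices H) (inRow x) + ∑[ x ∈ vertices G ] ∑ (vertices H) (inColumn x)
    ≡⟨ cong (_+ ∑[ x ∈ vertices G ] ∑ (vertices H) (inColumn x)) (∑-comm (vertices G) (vertices H) inRow) ⟩
      ∑[ y ∈ vertices H ] ∂ G (row N y) + ∑[ x ∈ vertices G ] ∂ H (column N x)
    ∎
    where
    open ≡-Reasoning
    inRow : V G → V H → ℕ
    inRow x y = ∑[ x′ ∈ vertices G ] (if adj G x x′ then cut N (x ⊗ y) (x′ ⊗ y) else 0)
    inColumn : V G → V H → ℕ
    inColumn x y = ∑[ y′ ∈ vertices H ] (if adj H y y′ then cut N (x ⊗ y) (x ⊗ y′) else 0)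

  module _ (BG : MaxBoundary G) (BH : MaxBoundary H) where

    defect⊗ : (C → Bool) → ℕ
    defect⊗ N = ∑[ y ∈ vertices H ] defect BG (row N y) + ∑[ x ∈ vertices G ] defect BH (column N x)

    ∂⊗+defect⊗ : ∀ N → boundary vertices⊗ adj⊗ N + defect⊗ N ≡ (ratio BG + ratio BH) * length vertices⊗
    ∂⊗+defect⊗ N = begin
        boundary vertices⊗ adj⊗ N + defect⊗ N
      ≡⟨ cong (_+ defect⊗ N) (∂⊗ N) ⟩
        (∑[ y ∈ vertices H ] ∂ G (row N y) + ∑[ x ∈ vertices G ] ∂ H (column N x)) + defect⊗ N
      ≡⟨ +-interchange (∑ (vertices H) (λ y → ∂ G (row N y))) _ _ _ ⟩
        (∑[ y ∈ vertices H ] ∂ G (row N y) + ∑[ y ∈ vertices H ] defect BG (row N y)) +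
        (∑[ x ∈ vertices G ] ∂ H (column N x) + ∑[ x ∈ vertices G ] defect BH (column N x))
      ≡⟨ sym (cong₂ _+_ (∑-+ (vertices H) _ _) (∑-+ (vertices G) _ _)) ⟩
        ∑[ y ∈ vertices H ] (∂ G (row N y) + defect BG (row N y)) +
        ∑[ x ∈ vertices G ] (∂ H (column N x) + defect BH (column N x))
      ≡⟨ cong₂ _+_ (∑-cong (vertices H) (λ y → ∂+defect BG (row N y)))
                   (∑-cong (vertices G) (λ x → ∂+defect BH (column N x))) ⟩
        ∑[ y ∈ vertices H ] (ratio BG * |G|) + ∑[ x ∈ vertices G ] (ratio BH * |H|)
      ≡⟨ cong₂ _+_ (∑-const (vertices H) _) (∑-const (vertices G) _) ⟩
        |H| * (ratio BG * |G|) + |G| * (ratio BH * |H|)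
      ≡⟨ solve 4 (λ g h r s → h :* (r :* g) :+ g :* (s :* h) := (r :+ s) :* (g :* h))
               refl |G| |H| (ratio BG) (ratio BH) ⟩
        (ratio BG + ratio BH) * (|G| * |H|)
      ≡⟨ cong ((ratio BG + ratio BH) *_) (sym (length-cartesianProductWith _⊗_ (vertices G) (vertices H))) ⟩
        (ratio BG + ratio BH) * length vertices⊗
      ∎
      where
      open ≡-Reasoning
      |G| |H| : ℕ
      |G| = length (vertices G)
      |H| = length (vertices H)

    defect⊗≡0⇔ : ∀ N → defect⊗ N ≡ 0 ⇔
      ((∀ y → defect BG (row N y) ≡ 0) × (∀ x → defect BH (column N x) ≡ 0))
    defect⊗≡0⇔ N = mk⇔
      (λ d≡0 → (λ y → ∑≡0⇒ (vertices H) _ (m+n≡0⇒m≡0 _ d≡0) (∈-vertices H y)) ,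
               (λ x → ∑≡0⇒ (vertices G) _ (m+n≡0⇒n≡0 _ d≡0) (∈-vertices G x)))
      (λ (rows , columns) → cong₂ _+_ (∑≡0⇐ (vertices H) _ rows) (∑≡0⇐ (vertices G) _ columns))

module Power (G : FiniteGraph) where

  eqVec-sound : ∀ {k} (u v : Vec (V G) k) → T (eqVec (eqᵇ G) u v) → u ≡ v
  eqVec-sound [] [] _ = refl
  eqVec-sound (x ∷ u) (y ∷ v) x∷u≡y∷v =
    let x≡y , u≡v = Equivalence.to T-∧ x∷u≡y∷v in cong₂ _∷_ (eqᵇ-sound G x y x≡y) (eqVec-sound u v u≡v)

  adjVec-irrefl : ∀ {k} (u : Vec (V G) k) → adjVec (eqᵇ G) (adj G) u u ≡ false
  adjVec-irrefl [] = refl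
  adjVec-irrefl (x ∷ u) rewrite adj-irrefl G x | adjVec-irrefl u = ∧-zeroʳ (eqᵇ G x x)

  ∈-allVec : ∀ {k} (u : Vec (V G) k) → u ∈ allVec (vertices G) k
  ∈-allVec [] = here refl
  ∈-allVec (x ∷ u) = ∈-cartesianProductWith⁺ _∷_ (∈-vertices G x) (∈-allVec u)

  Kronecker-allVec : ∀ k → Kronecker (eqVec (eqᵇ G) {k}) (allVec (vertices G) k)
  Kronecker-allVec zero [] g = +-identityʳ (g [])
  Kronecker-allVec (suc k) (x ∷ u) =
    Kronecker-cartesianProductWith {eqC = eqVec (eqᵇ G)} _∷_ {vertices G} {allVec (vertices G) k}
      (λ _ _ _ _ → refl) (eqᵇ-Kronecker G) (Kronecker-allVec k) x u

  power : ℕ → FiniteGraph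
  power k = record
    { V = Vec (V G) k
    ; vertices = allVec (vertices G) k
    ; ∈-vertices = ∈-allVec
    ; eqᵇ = eqVec (eqᵇ G)
    ; eqᵇ-sound = eqVec-sound
    ; eqᵇ-Kronecker = Kronecker-allVec k
    ; adj = adjVec (eqᵇ G) (adj G)
    ; adj-irrefl = adjVec-irrefl
    }

  length-allVec : ∀ k → length (allVec (vertices G) k) ≡ length (vertices G) ^ k
  length-allVec zero = refl
  length-allVec (suc k) = trans (length-cartesianProductWith _∷_ (vertices G) (allVec (vertices G) k))
    (cong (length (vertices G) *_) (length-allVec k))

  module _ (B : MaxBoundary G) where

    private
      module Step k = CartesianProduct G (power k) _∷_ (adjVec (eqᵇ G) (adj G)) (λ _ _ _ _ → refl)

    powerBoundary : ∀ k → MaxBoundary (power k)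
    powerBoundary zero = record { ratio = 0 ; defect = λ _ → 0 ; ∂+defect = λ _ → refl }
    powerBoundary (suc k) = record
      { ratio = ratio B + ratio (powerBoundary k)
      ; defect = Step.defect⊗ k B (powerBoundary k)
      ; ∂+defect = Step.∂⊗+defect⊗ k B (powerBoundary k)
      }

    ratio-power : ∀ k → ratio (powerBoundary k) ≡ k * ratio B
    ratio-power zero = refl
    ratio-power (suc k) = cong (ratio B +_) (ratio-power k)

    -- The point x₀ only witnesses that lines through every vertex exist.
    powerDefect≡0⇔ : V G → ∀ k N → defect (powerBoundary k) N ≡ 0 ⇔
      (∀ v i → defect B (λ z → N (v [ i ]≔ z)) ≡ 0)
    powerDefect≡0⇔ x₀ zero N = mk⇔ (λ _ v ()) (λ _ → refl)
    powerDefect≡0⇔ x₀ (suc k) N = mk⇔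
      (λ d≡0 → let rows , columns = Equivalence.to (Step.defect⊗≡0⇔ k B (powerBoundary k) N) d≡0 in
        λ { (x ∷ u) zero → rows u
          ; (x ∷ u) (suc i) → Equivalence.to (powerDefect≡0⇔ x₀ k (λ y → N (x ∷ y))) (columns x) u i })
      (λ lines → Equivalence.from (Step.defect⊗≡0⇔ k B (powerBoundary k) N)
        ( (λ u → lines (x₀ ∷ u) zero)
        , (λ x → Equivalence.from (powerDefect≡0⇔ x₀ k (λ y → N (x ∷ y))) (λ u i → lines (x ∷ u) (suc i)))))


-- Exhaustive search over the subsets of a finite set

Pattern : Set → Set
Pattern X = List (X × Bool)

holds : (X → Bool) → X × Bool → Bool
holds N (v , b) = does (N v ≟ᵇ b)

matches : (X → Bool) → Pattern X → Bool
matches N π = all (holds N) π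

avoids : List (Pattern X) → (X → Bool) → Bool
avoids πs N = all (λ π → not (matches N π)) πs

avoids-cong : ∀ {N N′ : X → Bool} → N ≗ N′ → ∀ πs → avoids πs N ≡ avoids πs N′
avoids-cong {N = N} {N′} N≗N′ [] = refl
avoids-cong {N = N} {N′} N≗N′ (π ∷ πs) = cong₂ (λ m a → not m ∧ a) (matches-cong π) (avoids-cong N≗N′ πs)
  where
  matches-cong : ∀ π → matches N π ≡ matches N′ π
  matches-cong [] = refl
  matches-cong ((v , b) ∷ π) = cong₂ (λ a m → does (a ≟ᵇ b) ∧ m) (N≗N′ v) (matches-cong π)

Partial : Set → Set
Partial X = X → Maybe Bool

assigned : Partial X → X × Bool → Bool
assigned ρ (v , b) with ρ v
... | just a = does (a ≟ᵇ b)
... | nothing = false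

matchesPartial : Partial X → Pattern X → Bool
matchesPartial ρ π = all (assigned ρ) π

extend : (X → X → Bool) → Partial X → X → Bool → Partial X
extend _≈ᵇ_ ρ p b v = if p ≈ᵇ v then just b else ρ v

-- Decides a property R of all predicates on a finite set that avoid the patterns πs, by
-- branching on their values point by point and pruning every branch matching a pattern.
search : (X → X → Bool) → List (Pattern X) → ((X → Bool) → Bool) → List X → Partial X → Bool
search _≈ᵇ_ πs R [] ρ = any (matchesPartial ρ) πs ∨ R (λ v → fromMaybe false (ρ v))
search _≈ᵇ_ πs R (p ∷ ps) ρ =
  any (matchesPartial ρ) πs ∨
  (search _≈ᵇ_ πs R ps (extend _≈ᵇ_ ρ p false) ∧ search _≈ᵇ_ πs R ps (extend _≈ᵇ_ ρ p true))

module SearchSoundness (_≈ᵇ_ : X → X → Bool) (≈ᵇ⇒≡ : ∀ u v → T (u ≈ᵇ v) → u ≡ v)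
  (≈ᵇ-refl : ∀ v → T (v ≈ᵇ v)) where

  Agrees : (X → Bool) → Partial X → Set
  Agrees N ρ = ∀ v b → ρ v ≡ just b → N v ≡ b

  Covers : Partial X → List X → Set
  Covers ρ ps = ∀ v → ρ v ≡ nothing → v ∈ ps

  module _ {πs : List (Pattern X)} {R : (X → Bool) → Bool} (N : X → Bool) (N-avoids : avoids πs N ≡ true) where

    assigned⇒ : ∀ {ρ} → Agrees N ρ → ∀ v b → T (assigned ρ (v , b)) → T (holds N (v , b))
    assigned⇒ {ρ} ag v b t with ρ v in ρv
    ... | just a rewrite ag v a ρv = t

    matchesPartial⇒matches : ∀ {ρ} → Agrees N ρ → ∀ π → T (matchesPartial ρ π) → T (matches N π)
    matchesPartial⇒matches ag [] _ = _
    matchesPartial⇒matches ag ((v , b) ∷ π) m =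
      let vb , m′ = Equivalence.to T-∧ m in
      Equivalence.from T-∧ (assigned⇒ ag v b vb , matchesPartial⇒matches ag π m′)

    unpruned : ∀ {ρ} → Agrees N ρ → ∀ {b} → T (any (matchesPartial ρ) πs ∨ b) → T b
    unpruned {ρ} ag t with Equivalence.to T-∨ t
    ... | inj₂ tb = tb
    ... | inj₁ some = ⊥-elim (avoided πs (Equivalence.from T-≡ N-avoids) some)
      where
      avoided : ∀ πs′ → T (avoids πs′ N) → T (any (matchesPartial ρ) πs′) → ⊥
      avoided (π ∷ πs′) av m with Equivalence.to T-∧ av | Equivalence.to T-∨ m
      ... | ¬π , _ | inj₁ mπ = T-not⇒¬T ¬π (matchesPartial⇒matches ag π mπ)
      ... | _ , av′ | inj₂ m′ = avoided πs′ av′ m′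

    agrees-extend : ∀ {ρ p b} → Agrees N ρ → N p ≡ b → Agrees N (extend _≈ᵇ_ ρ p b)
    agrees-extend {ρ} {p} ag Np v b′ eq with p ≈ᵇ v in p≈v
    ... | true rewrite ≈ᵇ⇒≡ p v (Equivalence.from T-≡ p≈v) = trans Np (just-injective eq)
    ... | false = ag v b′ eq

    covers-extend : ∀ {ρ p ps b} → Covers ρ (p ∷ ps) → Covers (extend _≈ᵇ_ ρ p b) ps
    covers-extend {ρ} {p} cov v eq with p ≈ᵇ v in p≈v
    ... | false with cov v eq
    ...   | here refl = ⊥-elim (subst T p≈v (≈ᵇ-refl p))
    ...   | there v∈ps = v∈ps

    search-sound′ : ∀ ps ρ → Agrees N ρ → Covers ρ ps → T (search _≈ᵇ_ πs R ps ρ) → ∃[ σ ] (N ≗ σ × T (R σ))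
    search-sound′ [] ρ ag cov t = (λ v → fromMaybe false (ρ v)) , N≗ , unpruned ag t
      where
      N≗ : ∀ v → N v ≡ fromMaybe false (ρ v)
      N≗ v with ρ v in ρv
      ... | just b = ag v b ρv
      ... | nothing with () ← cov v ρv
    search-sound′ (p ∷ ps) ρ ag cov t with Equivalence.to T-∧ (unpruned ag t) | N p in Np
    ... | t-false , _ | false = search-sound′ ps _ (agrees-extend ag Np) (covers-extend cov) t-false
    ... | _ , t-true | true = search-sound′ ps _ (agrees-extend ag Np) (covers-extend cov) t-true

    search-sound : ∀ points → (∀ v → v ∈ points) → search _≈ᵇ_ πs R points (λ _ → nothing) ≡ true →
      ∃[ σ ] (N ≗ σ × R σ ≡ true)
    search-sound points ∈-points found =
      let σ , N≗σ , Rσ = search-sound′ points _ (λ _ _ ()) (λ v _ → ∈-points v) (Equivalence.from T-≡ found)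
      in σ , N≗σ , Equivalence.to T-≡ Rσ

Fin²-sound : ∀ {k} (u v : Fin k × Fin k) →
  T (eqF (proj₁ u) (proj₁ v) ∧ eqF (proj₂ u) (proj₂ v)) → u ≡ v
Fin²-sound (a , b) (c , d) t =
  let a≡c , b≡d = Equivalence.to (T-∧ {eqF a c}) t
  in cong₂ _,_ (toWitness {a? = a ≟F c} a≡c) (toWitness {a? = b ≟F d} b≡d)

Fin²-refl : ∀ {k} (u : Fin k × Fin k) → T (eqF (proj₁ u) (proj₁ u) ∧ eqF (proj₂ u) (proj₂ u))
Fin²-refl (a , b) = Equivalence.from T-∧ (fromWitness {a? = a ≟F a} refl , fromWitness {a? = b ≟F b} refl)

∈-Fin² : ∀ {k} (u : Fin k × Fin k) → u ∈ cartesianProduct (allFin k) (allFin k)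
∈-Fin² (a , b) = ∈-cartesianProduct⁺ (∈-allFin a) (∈-allFin b)

Kronecker-Fin² : ∀ k (u : Fin k × Fin k) (g : Fin k × Fin k → ℕ) →
  ∑[ w ∈ cartesianProduct (allFin k) (allFin k) ]
    (if eqF (proj₁ u) (proj₁ w) ∧ eqF (proj₂ u) (proj₂ w) then g w else 0) ≡ g u
Kronecker-Fin² k (a , b) = Kronecker-cartesianProductWith
  {eqA = eqF} {eqB = eqF} {eqC = λ u w → eqF (proj₁ u) (proj₁ w) ∧ eqF (proj₂ u) (proj₂ w)} _,_
  {allFin k} {allFin k}
  (λ _ _ _ _ → refl) (Kronecker-allFin k) (Kronecker-allFin k) a b

sub4-refl : ∀ a → sub4 a a ≡ 0
sub4-refl zero = refl
sub4-refl (suc zero) = refl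
sub4-refl (suc (suc zero)) = refl
sub4-refl (suc (suc (suc zero))) = refl

sub2-refl : ∀ a → sub2 a a ≡ 0
sub2-refl zero = refl
sub2-refl (suc zero) = refl

Sh : FiniteGraph
Sh = record
  { V = Z4²
  ; vertices = allZ4²
  ; ∈-vertices = ∈-Fin²
  ; eqᵇ = eqZ4²
  ; eqᵇ-sound = Fin²-sound
  ; eqᵇ-Kronecker = Kronecker-Fin² 4
  ; adj = ShAdj
  ; adj-irrefl = λ (a , b) → cong₂ inS-Sh (sub4-refl a) (sub4-refl b)
  }

K4 : FiniteGraph
K4 = record
  { V = Z2²
  ; vertices = allZ2²
  ; ∈-vertices = ∈-Fin²
  ; eqᵇ = eqZ2²
  ; eqᵇ-sound = Fin²-sound
  ; eqᵇ-Kronecker = Kronecker-Fin² 2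
  ; adj = KAdj
  ; adj-irrefl = λ (a , b) → cong₂ inS-K (sub2-refl a) (sub2-refl b)
  }

-- A k-subset of K4 has boundary k (4 - k) = 4 - (k - 2)².
K4-boundary : MaxBoundary K4
K4-boundary = record
  { ratio = 1
  ; defect = squaredImbalance
  ; ∂+defect = ∂+squaredImbalance
  }
  where
  squaredImbalance : (Z2² → Bool) → ℕ
  squaredImbalance N = ∣ count N allZ2² - 2 ∣ ^ 2
  open SearchSoundness eqZ2² Fin²-sound Fin²-refl
  ∂+squaredImbalance : ∀ N → ∂ K4 N + squaredImbalance N ≡ 4
  ∂+squaredImbalance N =
    let σ , N≗σ , ok = search-sound {πs = []} {R = λ σ → (∂ K4 σ + squaredImbalance σ) ≡ᵇ 4}
                                    N refl allZ2² ∈-Fin² refl in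
    trans (cong₂ _+_ (boundary-cong allZ2² KAdj N≗σ) (cong (λ k → ∣ k - 2 ∣ ^ 2) (count-cong allZ2² N≗σ)))
          (≡ᵇ⇒≡ _ 4 (Equivalence.from T-≡ ok))

K4-defect≡0⇔ : ∀ N → defect K4-boundary N ≡ 0 ⇔ count N allZ2² ≡ 2
K4-defect≡0⇔ N = mk⇔
  (λ d≡0 → ∣m-n∣≡0⇒m≡n (m^n≡0⇒m≡0 _ 2 d≡0))
  (λ c≡2 → cong (_^ 2) (m≡n⇒∣m-n∣≡0 c≡2))

module ∑-Permutation {A : Set} (_≈ᵇ_ : A → A → Bool) (≈ᵇ⇒≡ : ∀ x y → T (x ≈ᵇ y) → x ≡ y) where

  remove : A → List A → Maybe (List A)
  remove x [] = nothing
  remove x (y ∷ ys) = if x ≈ᵇ y then just ys else Maybe.map (y ∷_) (remove x ys)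

  isPermutation : List A → List A → Bool
  isPermutation [] [] = true
  isPermutation [] (_ ∷ _) = false
  isPermutation (x ∷ xs) ys = maybe′ (isPermutation xs) false (remove x ys)

  module _ (f : A → ℕ) where

    ∑-remove : ∀ x ys {zs} → remove x ys ≡ just zs → ∑ ys f ≡ f x + ∑ zs f
    ∑-remove x (y ∷ ys) eq with x ≈ᵇ y in x≈y | remove x ys in removed
    ∑-remove x (y ∷ ys) refl | true | _ rewrite ≈ᵇ⇒≡ x y (Equivalence.from T-≡ x≈y) = refl
    ∑-remove x (y ∷ ys) refl | false | just zs =
      trans (cong (f y +_) (∑-remove x ys removed)) (+-comm-left (f y) (f x) (∑ zs f))
      where
      +-comm-left : ∀ a b c → a + (b + c) ≡ b + (a + c)
      +-comm-left a b c = trans (sym (+-assoc a b c)) (trans (cong (_+ c) (+-comm a b)) (+-assoc b a c))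

    ∑-isPermutation : ∀ xs ys → isPermutation xs ys ≡ true → ∑ xs f ≡ ∑ ys f
    ∑-isPermutation [] [] _ = refl
    ∑-isPermutation (x ∷ xs) ys perm with remove x ys in removed
    ... | just zs = trans (cong (f x +_) (∑-isPermutation xs zs perm)) (sym (∑-remove x ys removed))

inc : Fin 4 → Fin 4
inc zero = suc zero
inc (suc zero) = suc (suc zero)
inc (suc (suc zero)) = suc (suc (suc zero))
inc (suc (suc (suc zero))) = zero

Triangle : Set
Triangle = Z4² × Z4² × Z4²

-- {z, z + (1,0), z + (1,1)} and {z, z + (0,1), z + (1,1)}, for z ∈ ℤ₄²: all 32 triangles of Sh.
triangles : List Triangle
triangles = concatMap (λ (a , b) → ((a , b) , (inc a , b) , (inc a , inc b)) ∷
                                   ((a , b) , (a , inc b) , (inc a , inc b)) ∷ []) allZ4²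

monochromatic : (Z4² → Bool) → Triangle → Bool
monochromatic N (a , b , c) = (N a ∧ N b ∧ N c) ∨ (not (N a) ∧ not (N b) ∧ not (N c))

orientations : Triangle → List (Z4² × Z4²)
orientations (a , b , c) = (a , b) ∷ (b , a) ∷ (b , c) ∷ (c , b) ∷ (a , c) ∷ (c , a) ∷ []

edges : List (Z4² × Z4²)
edges = filterᵇ (uncurry ShAdj) (cartesianProduct allZ4² allZ4²)

eqArc : Z4² × Z4² → Z4² × Z4² → Bool
eqArc (u , v) (u′ , v′) = eqZ4² u u′ ∧ eqZ4² v v′

eqArc-sound : ∀ e e′ → T (eqArc e e′) → e ≡ e′
eqArc-sound (u , v) (u′ , v′) eq =
  let u≡u′ , v≡v′ = Equivalence.to (T-∧ {eqZ4² u u′}) eq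
  in cong₂ _,_ (Fin²-sound u u′ u≡u′) (Fin²-sound v v′ v≡v′)

open ∑-Permutation eqArc eqArc-sound

every-edge-in-two-triangles : isPermutation (concatMap orientations triangles) (edges ++ edges) ≡ true
every-edge-in-two-triangles = refl

cut-triangle : ∀ N t → ∑ (orientations t) (uncurry (cut N)) + 2 * ⟦ monochromatic N t ⟧ ≡ 2
cut-triangle N (a , b , c) with N a | N b | N c
... | true | true | true = refl
... | true | true | false = refl
... | true | false | true = refl
... | true | false | false = refl
... | false | true | true = refl
... | false | true | false = refl
... | false | false | true = refl
... | false | false | false = refl

∂Sh≡∑edges : ∀ N → ∂ Sh N ≡ ∑ edges (uncurry (cut N))
∂Sh≡∑edges N =
  trans (sym (∑-cartesianProductWith _,_ allZ4² allZ4² (λ e → if uncurry ShAdj e then uncurry (cut N) e else 0)))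
        (∑-filterᵇ (uncurry ShAdj) (cartesianProduct allZ4² allZ4²) (uncurry (cut N)))

Sh-boundary : MaxBoundary Sh
Sh-boundary = record
  { ratio = 2
  ; defect = monochromaticTriangles
  ; ∂+defect = λ N → *-cancelˡ-≡ _ _ 2 (doubled N)
  }
  where
  monochromaticTriangles : (Z4² → Bool) → ℕ
  monochromaticTriangles N = ∑[ t ∈ triangles ] ⟦ monochromatic N t ⟧
  doubled : ∀ N → 2 * (∂ Sh N + monochromaticTriangles N) ≡ 2 * 32
  doubled N = begin
      2 * (∂ Sh N + monochromaticTriangles N)
    ≡⟨ *-distribˡ-+ 2 (∂ Sh N) (monochromaticTriangles N) ⟩
      2 * ∂ Sh N + 2 * monochromaticTriangles N
    ≡⟨ cong₂ _+_ (trans (cong (2 *_) (∂Sh≡∑edges N)) (cong (cutEdges +_) (+-identityʳ cutEdges)))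
                 (sym (∑-*ˡ triangles 2 (λ t → ⟦ monochromatic N t ⟧))) ⟩
      (cutEdges + cutEdges) + ∑[ t ∈ triangles ] (2 * ⟦ monochromatic N t ⟧)
    ≡⟨ cong (_+ doubledMono)
         (sym (trans (∑-isPermutation (uncurry (cut N)) (concatMap orientations triangles) (edges ++ edges)
                                      every-edge-in-two-triangles)
                     (∑-++ edges edges (uncurry (cut N))))) ⟩
      ∑ (concatMap orientations triangles) (uncurry (cut N)) + ∑[ t ∈ triangles ] (2 * ⟦ monochromatic N t ⟧)
    ≡⟨ cong (_+ doubledMono) (∑-concatMap orientations triangles (uncurry (cut N))) ⟩
      ∑[ t ∈ triangles ] ∑ (orientations t) (uncurry (cut N)) + ∑[ t ∈ triangles ] (2 * ⟦ monochromatic N t ⟧)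
    ≡⟨ sym (∑-+ triangles (λ t → ∑ (orientations t) (uncurry (cut N))) (λ t → 2 * ⟦ monochromatic N t ⟧)) ⟩
      ∑[ t ∈ triangles ] (∑ (orientations t) (uncurry (cut N)) + 2 * ⟦ monochromatic N t ⟧)
    ≡⟨ trans (∑-cong triangles (cut-triangle N)) (∑-const triangles 2) ⟩
      2 * 32
    ∎
    where
    open ≡-Reasoning
    cutEdges doubledMono : ℕ
    cutEdges = ∑ edges (uncurry (cut N))
    doubledMono = ∑[ t ∈ triangles ] (2 * ⟦ monochromatic N t ⟧)

-- Subsets of Sh without monochromatic triangles

monochromaticPatterns : Triangle → List (Pattern Z4²)
monochromaticPatterns (a , b , c) =
  ((a , true) ∷ (b , true) ∷ (c , true) ∷ []) ∷ ((a , false) ∷ (b , false) ∷ (c , false) ∷ []) ∷ []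

monochromaticTrianglePatterns : List (Pattern Z4²)
monochromaticTrianglePatterns = concatMap monochromaticPatterns triangles

edgePattern : Z4² × Z4² → Pattern Z4²
edgePattern (u , v) = (u , true) ∷ (v , true) ∷ []

edgePatterns : List (Pattern Z4²)
edgePatterns = map edgePattern edges

bothIn : (Z4² → Bool) → Z4² × Z4² → Bool
bothIn A (u , v) = A u ∧ A v

independent : (Z4² → Bool) → Bool
independent A = all (λ e → not (bothIn A e)) edges

memberOf : List Z4² → Z4² → Bool
memberOf zs z = any (eqZ4² z) zs

disjoint : (Z4² → Bool) → (Z4² → Bool) → Bool
disjoint A B = all (λ z → not (A z ∧ B z)) allZ4²

_∖_ : (Z4² → Bool) → (Z4² → Bool) → Z4² → Bool
(N ∖ A) z = N z ∧ not (A z)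

has4 : (Z4² → Bool) → Bool
has4 S = count S allZ4² ≡ᵇ 4

splitsAlong : (Z4² → Bool) → (Z4² → Bool) → Bool
splitsAlong N A =
  all (λ z → not (A z) ∨ N z) allZ4² ∧ independent A ∧ has4 A ∧ independent (N ∖ A) ∧ has4 (N ∖ A)

-- All independent 4-sets of Sh; independent-4-set⇒listed checks that none is missing.
independent4Sets : List (List Z4²)
independent4Sets =
  ((# 0 , # 0) ∷ (# 0 , # 2) ∷ (# 2 , # 0) ∷ (# 2 , # 2) ∷ []) ∷
  ((# 0 , # 0) ∷ (# 0 , # 2) ∷ (# 2 , # 1) ∷ (# 2 , # 3) ∷ []) ∷
  ((# 0 , # 0) ∷ (# 1 , # 2) ∷ (# 2 , # 0) ∷ (# 3 , # 2) ∷ []) ∷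
  ((# 0 , # 0) ∷ (# 1 , # 3) ∷ (# 2 , # 2) ∷ (# 3 , # 1) ∷ []) ∷
  ((# 0 , # 1) ∷ (# 0 , # 3) ∷ (# 2 , # 0) ∷ (# 2 , # 2) ∷ []) ∷
  ((# 0 , # 1) ∷ (# 0 , # 3) ∷ (# 2 , # 1) ∷ (# 2 , # 3) ∷ []) ∷
  ((# 0 , # 1) ∷ (# 1 , # 0) ∷ (# 2 , # 3) ∷ (# 3 , # 2) ∷ []) ∷
  ((# 0 , # 1) ∷ (# 1 , # 3) ∷ (# 2 , # 1) ∷ (# 3 , # 3) ∷ []) ∷
  ((# 0 , # 2) ∷ (# 1 , # 0) ∷ (# 2 , # 2) ∷ (# 3 , # 0) ∷ []) ∷
  ((# 0 , # 2) ∷ (# 1 , # 1) ∷ (# 2 , # 0) ∷ (# 3 , # 3) ∷ []) ∷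
  ((# 0 , # 3) ∷ (# 1 , # 1) ∷ (# 2 , # 3) ∷ (# 3 , # 1) ∷ []) ∷
  ((# 0 , # 3) ∷ (# 1 , # 2) ∷ (# 2 , # 1) ∷ (# 3 , # 0) ∷ []) ∷
  ((# 1 , # 0) ∷ (# 1 , # 2) ∷ (# 3 , # 0) ∷ (# 3 , # 2) ∷ []) ∷
  ((# 1 , # 0) ∷ (# 1 , # 2) ∷ (# 3 , # 1) ∷ (# 3 , # 3) ∷ []) ∷
  ((# 1 , # 1) ∷ (# 1 , # 3) ∷ (# 3 , # 0) ∷ (# 3 , # 2) ∷ []) ∷
  ((# 1 , # 1) ∷ (# 1 , # 3) ∷ (# 3 , # 1) ∷ (# 3 , # 3) ∷ []) ∷ []

splitsIntoListedSets : (Z4² → Bool) → Bool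
splitsIntoListedSets σ = (count σ allZ4² ≡ᵇ 8) ∧ any (λ a → splitsAlong σ (memberOf a)) independent4Sets

listedIf4Set : (Z4² → Bool) → Bool
listedIf4Set σ =
  not (has4 σ) ∨ any (λ a → all (λ z → does (σ z ≟ᵇ memberOf a z)) allZ4²) independent4Sets

unionAvoidsIfDisjoint : List Z4² → List Z4² → Bool
unionAvoidsIfDisjoint a b =
  not (disjoint (memberOf a) (memberOf b)) ∨ avoids monochromaticTrianglePatterns (λ z → memberOf a z ∨ memberOf b z)

-- Stated as b ≡ true rather than T b: the type checker would re-evaluate T b whenever it
-- compares types mentioning it.
no-monochromatic-triangle⇒splits :
  search eqZ4² monochromaticTrianglePatterns splitsIntoListedSets allZ4² (λ _ → nothing) ≡ true
no-monochromatic-triangle⇒splits = refl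

independent-4-set⇒listed : search eqZ4² edgePatterns listedIf4Set allZ4² (λ _ → nothing) ≡ true
independent-4-set⇒listed = refl

disjoint-listed⇒no-monochromatic-triangle :
  all (λ a → all (unionAvoidsIfDisjoint a) independent4Sets) independent4Sets ≡ true
disjoint-listed⇒no-monochromatic-triangle = refl

open SearchSoundness eqZ4² Fin²-sound Fin²-refl

avoids-monochromatic : ∀ N ts →
  avoids (concatMap monochromaticPatterns ts) N ≡ all (λ t → not (monochromatic N t)) ts
avoids-monochromatic N [] = refl
avoids-monochromatic N ((a , b , c) ∷ ts) =
  trans (two-patterns (N a) (N b) (N c) _) (cong (not (monochromatic N (a , b , c)) ∧_) (avoids-monochromatic N ts))
  where
  lit : Bool → Bool → Bool
  lit x b = does (x ≟ᵇ b)
  two-patterns : ∀ x y z r →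
    not (lit x true ∧ (lit y true ∧ (lit z true ∧ true))) ∧ (not (lit x false ∧ (lit y false ∧ (lit z false ∧ true))) ∧ r)
    ≡ not ((x ∧ y ∧ z) ∨ (not x ∧ not y ∧ not z)) ∧ r
  two-patterns true true true r = refl
  two-patterns true true false r = refl
  two-patterns true false true r = refl
  two-patterns true false false r = refl
  two-patterns false true true r = refl
  two-patterns false true false r = refl
  two-patterns false false true r = refl
  two-patterns false false false r = refl

avoids-edgePatterns : ∀ A → avoids edgePatterns A ≡ independent A
avoids-edgePatterns A = go edges
  where
  lit : Bool → Bool
  lit x = does (x ≟ᵇ true)
  pattern-edge : ∀ x y r → not (lit x ∧ (lit y ∧ true)) ∧ r ≡ not (x ∧ y) ∧ r
  pattern-edge true true r = refl
  pattern-edge true false r = refl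
  pattern-edge false y r = refl
  go : ∀ es → avoids (map edgePattern es) A ≡ all (λ e → not (bothIn A e)) es
  go [] = refl
  go ((u , v) ∷ es) = trans (pattern-edge (A u) (A v) _) (cong (not (A u ∧ A v) ∧_) (go es))

monochromaticTriangles≡0⇔ : ∀ N → defect Sh-boundary N ≡ 0 ⇔ avoids monochromaticTrianglePatterns N ≡ true
monochromaticTriangles≡0⇔ N = mk⇔
  (λ d≡0 → trans (avoids-monochromatic N triangles) (Equivalence.to no-triangle d≡0))
  (λ av → Equivalence.from no-triangle (trans (sym (avoids-monochromatic N triangles)) av))
  where
  no-triangle : ∑[ t ∈ triangles ] ⟦ monochromatic N t ⟧ ≡ 0 ⇔ all (λ t → not (monochromatic N t)) triangles ≡ true
  no-triangle = ∑⟦⟧≡0⇔ (monochromatic N) triangles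

∈-edges : ∀ {u v} → ShAdj u v ≡ true → (u , v) ∈ edges
∈-edges {u} {v} uv =
  ∈-filter⁺ (T? ∘ uncurry ShAdj) (∈-cartesianProduct⁺ (∈-Fin² u) (∈-Fin² v)) (Equivalence.from T-≡ uv)

independent-sound : ∀ A → independent A ≡ true → IndependentSh A
independent-sound A ind z w Az Aw with ShAdj z w in zw
... | false = refl
... | true = contradiction
  (subst₂ (λ a b → not (a ∧ b) ≡ true) Az Aw (all-∈ (λ e → not (bothIn A e)) {edges} ind (∈-edges zw)))
  λ ()

independent-complete : ∀ A → IndependentSh A → independent A ≡ true
independent-complete A ind = Equivalence.to T-≡
  (all⁻ (λ e → not (bothIn A e)) {edges}
    (All.tabulate (λ {e} e∈edges →
      edge-ok e (Equivalence.to T-≡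
        (proj₂ (∈-filter⁻ (T? ∘ uncurry ShAdj) {xs = cartesianProduct allZ4² allZ4²} e∈edges))))))
  where
  edge-ok : ∀ e → uncurry ShAdj e ≡ true → T (not (bothIn A e))
  edge-ok (u , v) uv with A u in Au | A v in Av
  ... | true | true = contradiction (trans (sym (ind u v Au Av)) uv) λ ()
  ... | true | false = _
  ... | false | _ = _

UnionOfTwoIndependent4Sets-cong : ∀ {N σ} → N ≗ σ → UnionOfTwoIndependent4Sets σ → UnionOfTwoIndependent4Sets N
UnionOfTwoIndependent4Sets-cong N≗σ (c8 , A , B , cA , cB , indA , indB , disj , σ≡A∪B) =
  trans (count-cong allZ4² N≗σ) c8 , A , B , cA , cB , indA , indB , disj , λ z → trans (N≗σ z) (σ≡A∪B z)

splitsAlong-sound : ∀ N A → (count N allZ4² ≡ᵇ 8) ≡ true → splitsAlong N A ≡ true → UnionOfTwoIndependent4Sets N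
splitsAlong-sound N A c8 s =
  let A⊆N , s₁ = ∧⁻ (all (λ z → not (A z) ∨ N z) allZ4²) (independent A ∧ (has4 A ∧ (independent (N ∖ A) ∧ has4 (N ∖ A)))) s
      indA , s₂ = ∧⁻ (independent A) (has4 A ∧ (independent (N ∖ A) ∧ has4 (N ∖ A))) s₁
      cA , s₃ = ∧⁻ (has4 A) (independent (N ∖ A) ∧ has4 (N ∖ A)) s₂
      indB , cB = ∧⁻ (independent (N ∖ A)) (has4 (N ∖ A)) s₃
  in ≡ᵇ-sound 8 c8 , A , (N ∖ A) , ≡ᵇ-sound 4 cA , ≡ᵇ-sound 4 cB ,
     independent-sound A indA , independent-sound (N ∖ A) indB ,
     (λ z → disjoint-parts (A z) (N z)) ,
     (λ z → union-parts (A z) (N z) (all-∈ (λ z → not (A z) ∨ N z) A⊆N (∈-Fin² z)))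
  where
  ≡ᵇ-sound : ∀ {k} n → (k ≡ᵇ n) ≡ true → k ≡ n
  ≡ᵇ-sound n eq = ≡ᵇ⇒≡ _ n (Equivalence.from T-≡ eq)
  disjoint-parts : ∀ a n → (a ∧ (n ∧ not a)) ≡ false
  disjoint-parts true true = refl
  disjoint-parts true false = refl
  disjoint-parts false n = refl
  union-parts : ∀ a n → not a ∨ n ≡ true → n ≡ (a ∨ (n ∧ not a))
  union-parts true true _ = refl
  union-parts false true _ = refl
  union-parts false false _ = refl

no-monochromatic-triangle⇒union : ∀ N → avoids monochromaticTrianglePatterns N ≡ true → UnionOfTwoIndependent4Sets N
no-monochromatic-triangle⇒union N av =
  fromSearch (search-sound {πs = monochromaticTrianglePatterns} {R = splitsIntoListedSets} N av allZ4² ∈-Fin²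
                 no-monochromatic-triangle⇒splits)
  where
  fromSearch : ∃[ σ ] (N ≗ σ × splitsIntoListedSets σ ≡ true) → UnionOfTwoIndependent4Sets N
  fromSearch (σ , N≗σ , ok) =
    let c8 , listed = ∧⁻ (count σ allZ4² ≡ᵇ 8) (any (λ a → splitsAlong σ (memberOf a)) independent4Sets) ok
        a , _ , splits = any-∈ (λ a → splitsAlong σ (memberOf a)) independent4Sets listed
    in UnionOfTwoIndependent4Sets-cong N≗σ (splitsAlong-sound σ (memberOf a) c8 splits)

independent-4-set-listed : ∀ A → count A allZ4² ≡ 4 → IndependentSh A →
  ∃[ a ] (a ∈ independent4Sets × A ≗ memberOf a)
independent-4-set-listed A c4 ind =
  fromSearch (search-sound {πs = edgePatterns} {R = listedIf4Set} A
                 (trans (avoids-edgePatterns A) (independent-complete A ind)) allZ4² ∈-Fin² independent-4-set⇒listed)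
  where
  fromSearch : ∃[ σ ] (A ≗ σ × listedIf4Set σ ≡ true) → ∃[ a ] (a ∈ independent4Sets × A ≗ memberOf a)
  fromSearch (σ , A≗σ , ok) =
    let listed = ⇒ᵇ-elim (has4 σ) (any (λ a → all (λ z → does (σ z ≟ᵇ memberOf a z)) allZ4²) independent4Sets)
                   ok (Equivalence.to T-≡ (≡⇒≡ᵇ _ 4 (trans (sym (count-cong allZ4² A≗σ)) c4)))
        a , a∈ , σ≗a = any-∈ (λ a → all (λ z → does (σ z ≟ᵇ memberOf a z)) allZ4²) independent4Sets listed
    in a , a∈ , λ z → trans (A≗σ z) (≟ᵇ-sound (all-∈ (λ z → does (σ z ≟ᵇ memberOf a z)) σ≗a (∈-Fin² z)))

disjoint-listed⇒union-avoids : ∀ {a b} → a ∈ independent4Sets → b ∈ independent4Sets →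
  disjoint (memberOf a) (memberOf b) ≡ true →
  avoids monochromaticTrianglePatterns (λ z → memberOf a z ∨ memberOf b z) ≡ true
disjoint-listed⇒union-avoids {a} {b} a∈ b∈ =
  ⇒ᵇ-elim (disjoint (memberOf a) (memberOf b))
    (avoids monochromaticTrianglePatterns (λ z → memberOf a z ∨ memberOf b z))
    (all-∈ (unionAvoidsIfDisjoint a) {independent4Sets}
      (all-∈ (λ a → all (unionAvoidsIfDisjoint a) independent4Sets) {independent4Sets}
        disjoint-listed⇒no-monochromatic-triangle a∈) b∈)

union⇒no-monochromatic-triangle : ∀ N → UnionOfTwoIndependent4Sets N → avoids monochromaticTrianglePatterns N ≡ true
union⇒no-monochromatic-triangle N (_ , A , B , cA , cB , indA , indB , disj , N≡A∪B) =
  fromListed (independent-4-set-listed A cA indA) (independent-4-set-listed B cB indB)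
  where
  fromListed : ∃[ a ] (a ∈ independent4Sets × A ≗ memberOf a) → ∃[ b ] (b ∈ independent4Sets × B ≗ memberOf b) →
    avoids monochromaticTrianglePatterns N ≡ true
  fromListed (a , a∈ , A≗a) (b , b∈ , B≗b) =
    trans (avoids-cong (λ z → trans (N≡A∪B z) (cong₂ _∨_ (A≗a z) (B≗b z))) monochromaticTrianglePatterns)
          (disjoint-listed⇒union-avoids a∈ b∈
            (all-intro (λ z → not (memberOf a z ∧ memberOf b z)) allZ4²
              (λ z → cong not (trans (cong₂ _∧_ (sym (A≗a z)) (sym (B≗b z))) (disj z)))))

Sh-defect≡0⇔ : ∀ N → defect Sh-boundary N ≡ 0 ⇔ UnionOfTwoIndependent4Sets N
Sh-defect≡0⇔ N = mk⇔
  (no-monochromatic-triangle⇒union N ∘ Equivalence.to (monochromaticTriangles≡0⇔ N))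
  (Equivalence.from (monochromaticTriangles≡0⇔ N) ∘ union⇒no-monochromatic-triangle N)

-- The graph D(m,n)

module ShPower = Power Sh
module K4Power = Power K4
module DProduct (m n : ℕ) = CartesianProduct (ShPower.power m) (K4Power.power n) _,_ DAdj (λ _ _ _ _ → refl)

ShPowerBoundary : ∀ m → MaxBoundary (ShPower.power m)
ShPowerBoundary = ShPower.powerBoundary Sh-boundary

K4PowerBoundary : ∀ n → MaxBoundary (K4Power.power n)
K4PowerBoundary = K4Power.powerBoundary K4-boundary

D-defect : ∀ {m n} → VertexSet m n → ℕ
D-defect {m} {n} = DProduct.defect⊗ m n (ShPowerBoundary m) (K4PowerBoundary n)

⟦∧⟧≡if : ∀ a b c → ⟦ a ∧ b ∧ c ⟧ ≡ (if c then ⟦ a ∧ b ⟧ else 0)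
⟦∧⟧≡if true true true = refl
⟦∧⟧≡if true true false = refl
⟦∧⟧≡if true false true = refl
⟦∧⟧≡if true false false = refl
⟦∧⟧≡if false b true = refl
⟦∧⟧≡if false b false = refl

edgeBoundary≡boundary : ∀ {m n} (M : VertexSet m n) → edgeBoundary M ≡ boundary (allVertices m n) DAdj M
edgeBoundary≡boundary {m} {n} M = begin
    edgeBoundary M
  ≡⟨ count≡∑ _ (cartesianProduct (allVertices m n) (allVertices m n)) ⟩
    ∑[ e ∈ cartesianProduct (allVertices m n) (allVertices m n) ]
      ⟦ M (proj₁ e) ∧ not (M (proj₂ e)) ∧ DAdj (proj₁ e) (proj₂ e) ⟧
  ≡⟨ ∑-cartesianProductWith _,_ (allVertices m n) (allVertices m n) _ ⟩
    ∑[ u ∈ allVertices m n ] ∑[ v ∈ allVertices m n ] ⟦ M u ∧ not (M v) ∧ DAdj u v ⟧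
  ≡⟨ ∑-cong (allVertices m n) (λ u → ∑-cong (allVertices m n) λ v → ⟦∧⟧≡if (M u) (not (M v)) (DAdj u v)) ⟩
    boundary (allVertices m n) DAdj M
  ∎
  where open ≡-Reasoning

edgeBoundary+D-defect : ∀ {m n} (M : VertexSet m n) → edgeBoundary M + D-defect M ≡ (2 * m + n) * 4 ^ (2 * m + n)
edgeBoundary+D-defect {m} {n} M = begin
    edgeBoundary M + D-defect M
  ≡⟨ cong (_+ D-defect M) (edgeBoundary≡boundary M) ⟩
    boundary (allVertices m n) DAdj M + D-defect M
  ≡⟨ DProduct.∂⊗+defect⊗ m n (ShPowerBoundary m) (K4PowerBoundary n) M ⟩
    (ratio (ShPowerBoundary m) + ratio (K4PowerBoundary n)) * length-D
  ≡⟨ cong₂ (λ r s → (r + s) * length-D) (ShPower.ratio-power Sh-boundary m) (K4Power.ratio-power K4-boundary n) ⟩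
    (m * 2 + n * 1) * length-D
  ≡⟨ cong ((m * 2 + n * 1) *_) (trans (length-cartesianProductWith _,_ (allVec allZ4² m) (allVec allZ2² n))
                                       (cong₂ _*_ (ShPower.length-allVec m) (K4Power.length-allVec n))) ⟩
    (m * 2 + n * 1) * (16 ^ m * 4 ^ n)
  ≡⟨ cong₂ _*_ (cong₂ _+_ (*-comm m 2) (*-identityʳ n))
               (trans (cong (_* 4 ^ n) (^-*-assoc 4 2 m)) (sym (^-distribˡ-+-* 4 (2 * m) n))) ⟩
    (2 * m + n) * 4 ^ (2 * m + n)
  ∎
  where
  open ≡-Reasoning
  length-D : ℕ
  length-D = length (allVertices m n)

D-defect≡0⇔lines : ∀ {m n} (M : VertexSet m n) → D-defect M ≡ 0 ⇔
  ((∀ v i → defect Sh-boundary (shLineTrace M v i) ≡ 0) × (∀ v j → defect K4-boundary (kLineTrace M v j) ≡ 0))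
D-defect≡0⇔lines {m} {n} M = mk⇔
  (λ d≡0 → let rows , columns = Equivalence.to rows-columns d≡0 in
    (λ (x , y) → Equivalence.to (ShLines y) (rows y) x) , (λ (x , y) → Equivalence.to (K4Lines x) (columns x) y))
  (λ (sh-lines , k-lines) → Equivalence.from rows-columns
    ( (λ y → Equivalence.from (ShLines y) (λ x → sh-lines (x , y)))
    , (λ x → Equivalence.from (K4Lines x) (λ y → k-lines (x , y)))))
  where
  rows-columns : D-defect M ≡ 0 ⇔
    ((∀ y → defect (ShPowerBoundary m) (λ x → M (x , y)) ≡ 0) × (∀ x → defect (K4PowerBoundary n) (λ y → M (x , y)) ≡ 0))
  rows-columns = DProduct.defect⊗≡0⇔ m n (ShPowerBoundary m) (K4PowerBoundary n) M
  ShLines : ∀ y → defect (ShPowerBoundary m) (λ x → M (x , y)) ≡ 0 ⇔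
    (∀ x i → defect Sh-boundary (λ z → M ((x [ i ]≔ z) , y)) ≡ 0)
  ShLines y = ShPower.powerDefect≡0⇔ Sh-boundary (zero , zero) m (λ x → M (x , y))
  K4Lines : ∀ x → defect (K4PowerBoundary n) (λ y → M (x , y)) ≡ 0 ⇔
    (∀ y j → defect K4-boundary (λ z → M (x , (y [ j ]≔ z))) ≡ 0)
  K4Lines x = K4Power.powerDefect≡0⇔ K4-boundary (zero , zero) n (λ y → M (x , y))

D-defect≡0⇔2xMDS : ∀ {m n} (M : VertexSet m n) → D-defect M ≡ 0 ⇔ Is2xMDS M
D-defect≡0⇔2xMDS M = ⇔-trans (D-defect≡0⇔lines M) (mk⇔
  (λ (sh , k) → (λ v i → Equivalence.to (Sh-defect≡0⇔ (shLineTrace M v i)) (sh v i)) ,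
                (λ v j → Equivalence.to (K4-defect≡0⇔ (kLineTrace M v j)) (k v j)))
  (λ (sh , k) → (λ v i → Equivalence.from (Sh-defect≡0⇔ (shLineTrace M v i)) (sh v i)) ,
                (λ v j → Equivalence.from (K4-defect≡0⇔ (kLineTrace M v j)) (k v j))))

xorV : {A : Set} → (A → Bool) → {k : ℕ} → Vec A k → Bool
xorV f [] = false
xorV f (x ∷ v) = f x xor xorV f v

xorV-update : {A : Set} (f : A → Bool) {k : ℕ} (v : Vec A k) (i : Fin k) →
  ∃[ c ] (∀ z → xorV f (v [ i ]≔ z) ≡ f z xor c)
xorV-update f (x ∷ v) zero = xorV f v , λ z → refl
xorV-update f (x ∷ v) (suc i) =
  let c , upd = xorV-update f v i in
  f x xor c , λ z → trans (cong (f x xor_) (upd z)) (xor-swap (f x) (f z) c)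

even : Fin 4 → Bool
even zero = true
even (suc zero) = false
even (suc (suc zero)) = true
even (suc (suc (suc zero))) = false

equalParity : Z4² → Bool
equalParity (a , b) = not (even a xor even b)

firstIsZero : Z2² → Bool
firstIsZero (a , b) = eqF a zero

-- On every Shrikhande line this code is equalParity or its complement, and on every K-line
-- it is firstIsZero or its complement.
parityCode : (m n : ℕ) → VertexSet m n
parityCode m n (x , y) = xorV equalParity x xor xorV firstIsZero y

parityCode-2xMDS : ∀ m n → Is2xMDS (parityCode m n)
parityCode-2xMDS m n = sh-lines , k-lines
  where
  sh-lines : ∀ v i → UnionOfTwoIndependent4Sets (shLineTrace (parityCode m n) v i)
  sh-lines (x , y) i =
    let c , upd = xorV-update equalParity x i in
    UnionOfTwoIndependent4Sets-cong (λ z → trans (cong (_xor xorV firstIsZero y) (upd z)) (xor-assoc (equalParity z) c _))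
      (Equivalence.to (Sh-defect≡0⇔ (λ z → equalParity z xor (c xor xorV firstIsZero y)))
                      (translate (c xor xorV firstIsZero y)))
    where
    translate : ∀ c → defect Sh-boundary (λ z → equalParity z xor c) ≡ 0
    translate true = refl
    translate false = refl
  k-lines : ∀ v j → count (kLineTrace (parityCode m n) v j) allZ2² ≡ 2
  k-lines (x , y) j =
    let c , upd = xorV-update firstIsZero y j in
    trans (count-cong allZ2² (λ z → trans (cong (xorV equalParity x xor_) (upd z))
                                          (xor-swap (xorV equalParity x) (firstIsZero z) c)))
      (translate (xorV equalParity x xor c))
    where
    translate : ∀ c → count (λ z → firstIsZero z xor c) allZ2² ≡ 2
    translate true = refl
    translate false = refl

proposition2 : (m n : ℕ) →
    (((M : VertexSet m n) → edgeBoundary M ≤ (2 * m + n) * 4 ^ (2 * m + n)) ×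
     Σ (VertexSet m n) (λ M → edgeBoundary M ≡ (2 * m + n) * 4 ^ (2 * m + n))) ×
    ((M : VertexSet m n) → (edgeBoundary M ≡ (2 * m + n) * 4 ^ (2 * m + n)) ⇔ Is2xMDS M)
proposition2 m n =
  ( (λ M → subst (edgeBoundary M ≤_) (edgeBoundary+D-defect M) (m≤m+n (edgeBoundary M) (D-defect M)))
  , parityCode m n , Equivalence.from (maximal⇔2xMDS (parityCode m n)) (parityCode-2xMDS m n))
  , maximal⇔2xMDS
  where
  maximal⇔2xMDS : ∀ M → edgeBoundary M ≡ (2 * m + n) * 4 ^ (2 * m + n) ⇔ Is2xMDS M
  maximal⇔2xMDS M = ⇔-trans (+≡⇒[≡⇔≡0] (edgeBoundary+D-defect M)) (D-defect≡0⇔2xMDS M)
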